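{- Let $n$ be a positive integer and $\mathrm{TH}_m=\binom{m+2}{3}$. The sequence $(\mathrm{TH}_n,\mathrm{TH}_{n+1},\mathrm{TH}_{n+2},\mathrm{TH}_{n+3})$ is telescopic if and only if $n\equiv r \pmod 6$ with $r\in\{0,1,2,3\}$.
   Context: Let $(a_1,\ldots,a_k)$ ($k\ge2$) be a sequence of positive integers with $\gcd\{a_1,\ldots,a_k\}=1$, and let $d_i=\gcd\{a_1,\ldots,a_i\}$ for $i=1,\ldots,k$. The sequence is telescopic if, for every $i=2,\ldots,k$, the integer $a_i/d_i$ is a non-negative integer linear combination of $a_1/d_{i-1},\ldots,a_{i-1}/d_{i-1}$. -}

module Defs where

open import Data.Nat using (ℕ; zero; suc; _+_; _*_; _/_; _≤_; _>_)
open import Data.Nat.GCD using (gcd)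
open import Data.Nat.Combinatorics using (_C_)
open import Data.List using (List; []; _∷_; length; take; foldr; zipWith; lookup; map)
open import Data.Nat.ListAction using (sum)
open import Data.List.Relation.Unary.All using (All)
open import Data.Fin using (Fin; toℕ)
open import Data.Product using (Σ; _×_)
open import Relation.Binary.PropositionalEquality using (_≡_)

-- Total division; only ever applied with a positive divisor below
-- (all entries are positive, so every prefix gcd d_i is positive).
_div_ : ℕ → ℕ → ℕ
m div zero = 0
m div (suc d) = m / suc d

gcdL : List ℕ → ℕ
gcdL = foldr gcd 0

IsNNComb : ℕ → List ℕ → Set
IsNNComb y xs = Σ (List ℕ) λ cs → (length cs ≡ length xs) × (y ≡ sum (zipWith _*_ cs xs))

-- With 0-based index i
-- (corresponding to the paper's index i+1), the paper's d_{i+1} is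
-- gcdL (take (suc i) as) and d_i is gcdL (take i as); the condition for
-- paper-indices 2..k is the condition for 0-based i = 1..k-1.
Telescopic : List ℕ → Set
Telescopic as =
  (2 ≤ length as) × All (λ a → a > 0) as × (gcdL as ≡ 1) ×
  ((i : Fin (length as)) → 1 ≤ toℕ i →
     IsNNComb (lookup as i div gcdL (take (suc (toℕ i)) as))
              (map (λ a → a div gcdL (take (toℕ i) as)) (take (toℕ i) as)))

TH : ℕ → ℕ
TH m = (m + 2) C 3

-- Write n = 6k + r. Each TH (n + i) factors into linear polynomials in k, and in every residue
-- class the sequence has the shape (d u x₀, d u x₁, d v, a₃) with x₀, x₁ coprime and u, v coprime,
-- so its prefix gcds are d u and d. The telescopic conditions then read: d and a₃ are coprime,
-- v is a non-negative combination of x₀, x₁, and a₃ one of u x₀, u x₁, v. For r = 0, 1, 2, 3 all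
-- of this holds, with Bézout identities and explicit coefficients as certificates. For r = 5
-- the second condition fails because (4 + 3k)(3 + 2k) is not a non-negative combination of
-- 5 + 6k and 8 + 6k; for r = 4 the third one fails, and reduces to the same obstruction.

module Submission where

open import Defs
open import Data.Nat
  using (ℕ; zero; suc; _+_; _*_; _/_; _%_; _≤_; _<_; _>_; z≤n; s≤s; NonZero; >-nonZero; >-nonZero⁻¹)
open import Data.Nat.Properties
open import Data.Nat.Divisibility using (_∣_; divides; ∣m+n∣m⇒∣n; n∣m*n; ∣-trans)
open import Data.Nat.DivMod using (m*n/n≡m; n/n≡1; n/1≡n; m≡m%n+[m/n]*n; m%n<n)
open import Data.Nat.GCD using (gcd; gcd-assoc; gcd-identityˡ; gcd-identityʳ; c*gcd[m,n]≡gcd[cm,cn]; module Bézout)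
open import Data.Nat.Coprimality using (Coprime; Bézout-coprime; coprime-divisor; coprime⇒gcd≡1; gcd≡1⇒coprime)
open import Data.Nat.Combinatorics using (_C_; nCk+nC[k+1]≡[n+1]C[k+1]; nC1≡n)
open import Data.Nat.Tactic.RingSolver using (solve)
open import Data.List using (List; _∷_; []; _++_; lookup; take; map)
open import Data.List.Relation.Unary.All as All using (All)
open import Data.Fin using (Fin; zero; suc; toℕ)
open import Data.Product using (_×_; _,_; proj₁; proj₂)
open import Data.Sum using (_⊎_; inj₁; inj₂)
open import Data.Empty using (⊥-elim)
open import Function using (_∘_; const)
open import Function.Bundles using (_⇔_; mk⇔; Equivalence)
open import Function.Construct.Composition using (_⇔-∘_)
open import Relation.Nullary using (¬_)
open import Relation.Binary using (tri<; tri≈; tri>)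
open import Relation.Binary.PropositionalEquality

open Equivalence using (to; from)

Bézout⇒coprime : ∀ m n → Bézout.Identity 1 m n → Coprime m n
Bézout⇒coprime m n = Bézout-coprime ∘ subst₂ (Bézout.Identity 1) (sym (*-identityʳ m)) (sym (*-identityʳ n))

coprime-*ʳ : ∀ {m n o} → Coprime m n → Coprime m o → Coprime m (n * o)
coprime-*ʳ {n = n} m⊥n m⊥o {d} (d∣m , d∣n*o) = m⊥o (d∣m , coprime-divisor d⊥n d∣n*o)
  where
  d⊥n : Coprime d n
  d⊥n (e∣d , e∣n) = m⊥n (∣-trans e∣d d∣m , e∣n)

gcd[c*m,c*n]≡c : ∀ c {m n} → Coprime m n → gcd (c * m) (c * n) ≡ c
gcd[c*m,c*n]≡c c {m} {n} m⊥n = begin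
  gcd (c * m) (c * n) ≡⟨ c*gcd[m,n]≡gcd[cm,cn] c m n ⟨
  c * gcd m n         ≡⟨ cong (c *_) (coprime⇒gcd≡1 m⊥n) ⟩
  c * 1               ≡⟨ *-identityʳ c ⟩
  c                   ∎
  where open ≡-Reasoning

gcdL-∷ʳ : ∀ xs x → gcdL (xs ++ x ∷ []) ≡ gcd (gcdL xs) x
gcdL-∷ʳ []       x = trans (gcd-identityʳ x) (sym (gcd-identityˡ x))
gcdL-∷ʳ (y ∷ ys) x = trans (cong (gcd y) (gcdL-∷ʳ ys x)) (sym (gcd-assoc y (gcdL ys) x))

m*n-div-m≡n : ∀ m n .{{_ : NonZero m}} → (m * n) div m ≡ n
m*n-div-m≡n (suc m) n = trans (cong (_/ suc m) (*-comm (suc m) n)) (m*n/n≡m n (suc m))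

m*n*o-div-m≡n*o : ∀ m n o .{{_ : NonZero m}} → (m * n * o) div m ≡ n * o
m*n*o-div-m≡n*o m n o = trans (cong (_div m) (*-assoc m n o)) (m*n-div-m≡n m (n * o))

n-div-n≡1 : ∀ n .{{_ : NonZero n}} → n div n ≡ 1
n-div-n≡1 (suc n) = n/n≡1 (suc n)

IsNNComb-[1] : ∀ y {x} → x ≡ 1 → IsNNComb y (x ∷ [])
IsNNComb-[1] y refl = y ∷ [] , refl , sym (trans (+-identityʳ (y * 1)) (*-identityʳ y))

nnComb₂ : ∀ {y a b} c₁ c₂ → y ≡ c₁ * a + c₂ * b → IsNNComb y (a ∷ b ∷ [])
nnComb₂ {a = a} {b} c₁ c₂ eq =
  (c₁ ∷ c₂ ∷ []) , refl , trans eq (cong (c₁ * a +_) (sym (+-identityʳ (c₂ * b))))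

nnComb₃ : ∀ {y a b c} c₁ c₂ c₃ → y ≡ c₁ * a + (c₂ * b + c₃ * c) → IsNNComb y (a ∷ b ∷ c ∷ [])
nnComb₃ {a = a} {b} {c} c₁ c₂ c₃ eq =
  (c₁ ∷ c₂ ∷ c₃ ∷ []) , refl ,
  trans eq (cong (λ z → c₁ * a + (c₂ * b + z)) (sym (+-identityʳ (c₃ * c))))

coprime-coefficient : ∀ {p g t c r} → Coprime p g → t * p ≡ c * g + r * p → p ∣ c
coprime-coefficient {p} {g} {t} {c} {r} p⊥g eq =
  coprime-divisor p⊥g (∣m+n∣m⇒∣n (subst (p ∣_) rearranged (n∣m*n t)) (n∣m*n r))
  where
  rearranged : t * p ≡ r * p + g * c
  rearranged = trans eq (trans (+-comm (c * g) (r * p)) (cong (r * p +_) (*-comm c g)))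

below-multiple : ∀ {t g} k {x} → t < g → t ≡ k * g + x → t ≡ x
below-multiple zero    _   t≡x = t≡x
below-multiple {g = g} (suc k) t<g t≡ =
  ⊥-elim (<⇒≱ t<g (subst (g ≤_) (sym t≡) (≤-trans (m≤m+n g (k * g)) (m≤m+n _ _))))

IsNNComb-cancel : ∀ {p g t h₁ h₂} .{{_ : NonZero p}} → Coprime p g → t < g →
  IsNNComb (t * p) (g ∷ h₁ * p ∷ h₂ * p ∷ []) → IsNNComb t (h₁ ∷ h₂ ∷ [])
IsNNComb-cancel {p} {g} {t} {h₁} {h₂} p⊥g t<g ((c₀ ∷ c₁ ∷ c₂ ∷ []) , _ , eq) =
  nnComb₂ c₁ c₂ (cancel c₀ eq)
  where
  cancel : ∀ c₀ → t * p ≡ c₀ * g + (c₁ * (h₁ * p) + (c₂ * (h₂ * p) + 0)) → t ≡ c₁ * h₁ + c₂ * h₂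
  cancel c₀ tp≡ with divides e refl ← coprime-coefficient {t = t} {c₀} {c₁ * h₁ + c₂ * h₂} p⊥g
                                        (trans tp≡ (solve (c₀ ∷ c₁ ∷ c₂ ∷ g ∷ h₁ ∷ h₂ ∷ p ∷ [])))
    = below-multiple e t<g (*-cancelʳ-≡ t (e * g + (c₁ * h₁ + c₂ * h₂)) p
                             (trans tp≡ (solve (e ∷ c₁ ∷ c₂ ∷ g ∷ h₁ ∷ h₂ ∷ p ∷ []))))

telescopic₄⇔ : ∀ {a₀ a₁ a₂ a₃ d₂ d₃} → All (_> 0) (a₀ ∷ a₁ ∷ a₂ ∷ a₃ ∷ []) →
  gcd a₀ a₁ ≡ d₂ → gcd d₂ a₂ ≡ d₃ →
  Telescopic (a₀ ∷ a₁ ∷ a₂ ∷ a₃ ∷ []) ⇔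
    (gcd d₃ a₃ ≡ 1 ×
     IsNNComb (a₂ div d₃) (a₀ div d₂ ∷ a₁ div d₂ ∷ []) ×
     IsNNComb a₃ (a₀ div d₃ ∷ a₁ div d₃ ∷ a₂ div d₃ ∷ []))
telescopic₄⇔ {a₀} {a₁} {a₂} {a₃} positive@(a₀>0 All.∷ _) refl refl = mk⇔ to′ from′
  where
  as : List ℕ
  as = a₀ ∷ a₁ ∷ a₂ ∷ a₃ ∷ []
  d₂ d₃ : ℕ
  d₂ = gcd a₀ a₁
  d₃ = gcd d₂ a₂

  gcdL₂ : gcdL (a₀ ∷ a₁ ∷ []) ≡ d₂
  gcdL₂ = cong (gcd a₀) (gcd-identityʳ a₁)
  gcdL₃ : gcdL (a₀ ∷ a₁ ∷ a₂ ∷ []) ≡ d₃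
  gcdL₃ = trans (gcdL-∷ʳ (a₀ ∷ a₁ ∷ []) a₂) (cong (λ g → gcd g a₂) gcdL₂)
  gcdL₄ : gcdL as ≡ gcd d₃ a₃
  gcdL₄ = trans (gcdL-∷ʳ (a₀ ∷ a₁ ∷ a₂ ∷ []) a₃) (cong (λ g → gcd g a₃) gcdL₃)

  Step₂ : ℕ → ℕ → Set
  Step₂ e₂ e₃ = IsNNComb (a₂ div e₃) (a₀ div e₂ ∷ a₁ div e₂ ∷ [])
  Step₃ : ℕ → ℕ → Set
  Step₃ e₃ y = IsNNComb y (a₀ div e₃ ∷ a₁ div e₃ ∷ a₂ div e₃ ∷ [])
  Step : Fin 4 → Set
  Step i = IsNNComb (lookup as i div gcdL (take (suc (toℕ i)) as))
                    (map (λ a → a div gcdL (take (toℕ i) as)) (take (toℕ i) as))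

  a₃-div-gcdL : gcd d₃ a₃ ≡ 1 → a₃ div gcdL as ≡ a₃
  a₃-div-gcdL coprime = trans (cong (a₃ div_) (trans gcdL₄ coprime)) (n/1≡n a₃)

  to′ : Telescopic as → gcd d₃ a₃ ≡ 1 × Step₂ d₂ d₃ × Step₃ d₃ a₃
  to′ (_ , _ , gcdL≡1 , step) =
    coprime ,
    subst₂ Step₂ gcdL₂ gcdL₃ (step (suc (suc zero)) (s≤s z≤n)) ,
    subst₂ Step₃ gcdL₃ (a₃-div-gcdL coprime) (step (suc (suc (suc zero))) (s≤s z≤n))
    where
    coprime : gcd d₃ a₃ ≡ 1
    coprime = trans (sym gcdL₄) gcdL≡1

  from′ : gcd d₃ a₃ ≡ 1 × Step₂ d₂ d₃ × Step₃ d₃ a₃ → Telescopic as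
  from′ (coprime , step₂ , step₃) = s≤s (s≤s z≤n) , positive , trans gcdL₄ coprime , step
    where
    step : (i : Fin 4) → 1 ≤ toℕ i → Step i
    step (suc zero) _ =
      IsNNComb-[1] _ (trans (cong (a₀ div_) (gcd-identityʳ a₀)) (n-div-n≡1 a₀ {{>-nonZero a₀>0}}))
    step (suc (suc zero)) _ = subst₂ Step₂ (sym gcdL₂) (sym gcdL₃) step₂
    step (suc (suc (suc zero))) _ = subst₂ Step₃ (sym gcdL₃) (sym (a₃-div-gcdL coprime)) step₃

-- The prefix gcds of this sequence are d * u and d.
telescopic-shape⇔ : ∀ d u x₀ x₁ v a₃ .{{_ : NonZero d}} .{{_ : NonZero u}} .{{_ : NonZero x₀}}
  .{{_ : NonZero x₁}} .{{_ : NonZero v}} .{{_ : NonZero a₃}} → Coprime x₀ x₁ → Coprime u v →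
  Telescopic (d * u * x₀ ∷ d * u * x₁ ∷ d * v ∷ a₃ ∷ []) ⇔
    (Coprime d a₃ × IsNNComb v (x₀ ∷ x₁ ∷ []) × IsNNComb a₃ (u * x₀ ∷ u * x₁ ∷ v ∷ []))
telescopic-shape⇔ d u x₀ x₁ v a₃ x₀⊥x₁ u⊥v =
  quotients⇔ ⇔-∘ telescopic₄⇔ positive (gcd[c*m,c*n]≡c (d * u) x₀⊥x₁) (gcd[c*m,c*n]≡c d u⊥v)
  where
  instance
    du≢0 : NonZero (d * u)
    du≢0 = m*n≢0 d u

  positive : All (_> 0) (d * u * x₀ ∷ d * u * x₁ ∷ d * v ∷ a₃ ∷ [])
  positive = >-nonZero⁻¹ _ {{m*n≢0 (d * u) x₀}} All.∷ >-nonZero⁻¹ _ {{m*n≢0 (d * u) x₁}} All.∷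
             >-nonZero⁻¹ _ {{m*n≢0 d v}} All.∷ >-nonZero⁻¹ a₃ All.∷ All.[]

  v≡ : (d * v) div d ≡ v
  v≡ = m*n-div-m≡n d v
  xs≡ : (d * u * x₀) div (d * u) ∷ (d * u * x₁) div (d * u) ∷ [] ≡ x₀ ∷ x₁ ∷ []
  xs≡ = cong₂ _∷_ (m*n-div-m≡n (d * u) x₀) (cong (_∷ []) (m*n-div-m≡n (d * u) x₁))
  ys≡ : (d * u * x₀) div d ∷ (d * u * x₁) div d ∷ (d * v) div d ∷ [] ≡ u * x₀ ∷ u * x₁ ∷ v ∷ []
  ys≡ = cong₂ _∷_ (m*n*o-div-m≡n*o d u x₀) (cong₂ _∷_ (m*n*o-div-m≡n*o d u x₁) (cong (_∷ []) v≡))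

  quotients⇔ :
    (gcd d a₃ ≡ 1 ×
     IsNNComb ((d * v) div d) ((d * u * x₀) div (d * u) ∷ (d * u * x₁) div (d * u) ∷ []) ×
     IsNNComb a₃ ((d * u * x₀) div d ∷ (d * u * x₁) div d ∷ (d * v) div d ∷ []))
    ⇔ (Coprime d a₃ × IsNNComb v (x₀ ∷ x₁ ∷ []) × IsNNComb a₃ (u * x₀ ∷ u * x₁ ∷ v ∷ []))
  quotients⇔ = mk⇔
    (λ (g , c₂ , c₃) → gcd≡1⇒coprime g , subst₂ IsNNComb v≡ xs≡ c₂ , subst (IsNNComb a₃) ys≡ c₃)
    (λ (d⊥a₃ , c₂ , c₃) → coprime⇒gcd≡1 d⊥a₃ , subst₂ IsNNComb (sym v≡) (sym xs≡) c₂ ,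
                           subst (IsNNComb a₃) (sym ys≡) c₃)

[1+n]C2*2≡[1+n]*n : ∀ n → (suc n C 2) * 2 ≡ suc n * n
[1+n]C2*2≡[1+n]*n zero    = refl
[1+n]C2*2≡[1+n]*n (suc n) = begin
  (suc (suc n) C 2) * 2                 ≡⟨ cong (_* 2) (nCk+nC[k+1]≡[n+1]C[k+1] (suc n) 1) ⟨
  ((suc n C 1) + (suc n C 2)) * 2       ≡⟨ *-distribʳ-+ 2 (suc n C 1) (suc n C 2) ⟩
  (suc n C 1) * 2 + (suc n C 2) * 2     ≡⟨ cong₂ (λ a b → a * 2 + b) (nC1≡n (suc n)) ([1+n]C2*2≡[1+n]*n n) ⟩
  suc n * 2 + suc n * n                 ≡⟨ solve (n ∷ []) ⟩
  suc (suc n) * suc n                   ∎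
  where open ≡-Reasoning

[3+n]C3*6≡[3+n]*[2+n]*[1+n] : ∀ n → ((3 + n) C 3) * 6 ≡ (3 + n) * (2 + n) * (1 + n)
[3+n]C3*6≡[3+n]*[2+n]*[1+n] zero    = refl
[3+n]C3*6≡[3+n]*[2+n]*[1+n] (suc n) = begin
  ((4 + n) C 3) * 6                         ≡⟨ cong (_* 6) (nCk+nC[k+1]≡[n+1]C[k+1] (3 + n) 2) ⟨
  (((3 + n) C 2) + ((3 + n) C 3)) * 6       ≡⟨ *-distribʳ-+ 6 ((3 + n) C 2) ((3 + n) C 3) ⟩
  ((3 + n) C 2) * 6 + ((3 + n) C 3) * 6     ≡⟨ cong (_+ ((3 + n) C 3) * 6) (*-assoc ((3 + n) C 2) 2 3) ⟨
  ((3 + n) C 2) * 2 * 3 + ((3 + n) C 3) * 6 ≡⟨ cong₂ (λ a b → a * 3 + b) ([1+n]C2*2≡[1+n]*n (2 + n))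
                                                                        ([3+n]C3*6≡[3+n]*[2+n]*[1+n] n) ⟩
  (3 + n) * (2 + n) * 3 + (3 + n) * (2 + n) * (1 + n) ≡⟨ solve (n ∷ []) ⟩
  (4 + n) * (3 + n) * (2 + n)               ∎
  where open ≡-Reasoning

TH*6≡m*[m+1]*[m+2] : ∀ m → TH m * 6 ≡ m * (m + 1) * (m + 2)
TH*6≡m*[m+1]*[m+2] zero    = refl
TH*6≡m*[m+1]*[m+2] (suc m) = begin
  ((suc m + 2) C 3) * 6             ≡⟨ cong (λ k → (k C 3) * 6) (+-comm (suc m) 2) ⟩
  ((3 + m) C 3) * 6                 ≡⟨ [3+n]C3*6≡[3+n]*[2+n]*[1+n] m ⟩
  (3 + m) * (2 + m) * (1 + m)       ≡⟨ solve (m ∷ []) ⟩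
  suc m * (suc m + 1) * (suc m + 2) ∎
  where open ≡-Reasoning

TH≡ : ∀ m {t} → t * 6 ≡ m * (m + 1) * (m + 2) → TH m ≡ t
TH≡ m {t} eq = *-cancelʳ-≡ (TH m) t 6 (trans (TH*6≡m*[m+1]*[m+2] m) (sym eq))

THs : ℕ → List ℕ
THs n = TH n ∷ TH (n + 1) ∷ TH (n + 2) ∷ TH (n + 3) ∷ []

THs≡ : ∀ n {t₀ t₁ t₂ t₃} →
  t₀ * 6 ≡ n * (n + 1) * (n + 2) → t₁ * 6 ≡ (n + 1) * (n + 1 + 1) * (n + 1 + 2) →
  t₂ * 6 ≡ (n + 2) * (n + 2 + 1) * (n + 2 + 2) → t₃ * 6 ≡ (n + 3) * (n + 3 + 1) * (n + 3 + 2) →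
  THs n ≡ t₀ ∷ t₁ ∷ t₂ ∷ t₃ ∷ []
THs≡ n e₀ e₁ e₂ e₃ =
  cong₂ _∷_ (TH≡ n e₀) (cong₂ _∷_ (TH≡ (n + 1) e₁)
    (cong₂ _∷_ (TH≡ (n + 2) e₂) (cong (_∷ []) (TH≡ (n + 3) e₃))))

-- c₁ (5 + 6k) + c₂ (8 + 6k) = (5 + 6k)(c₁ + c₂) + 3 c₂, while the target is (5 + 6k)(k + 2) + 2:
-- comparing sizes forces c₁ + c₂ = k + 2, and then 3 c₂ = 2.
[4+3k][3+2k]∉⟨5+6k,8+6k⟩ : ∀ k → ¬ IsNNComb ((4 + 3 * k) * (3 + 2 * k)) (5 + 6 * k ∷ 8 + 6 * k ∷ [])
[4+3k][3+2k]∉⟨5+6k,8+6k⟩ k ((c₁ ∷ c₂ ∷ []) , _ , eq) with <-cmp (c₁ + c₂) (2 + k)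
... | tri< c₁+c₂<2+k _ _ with o , c₁+c₂+1+o≡2+k ← m≤n⇒∃[o]m+o≡n c₁+c₂<2+k =
  m+1+n≢m ((8 + 6 * k) * (2 + k)) (sym (begin
    (8 + 6 * k) * (2 + k)
      ≡⟨ cong ((8 + 6 * k) *_) c₁+c₂+1+o≡2+k ⟨
    (8 + 6 * k) * (suc (c₁ + c₂) + o)
      ≡⟨ solve (k ∷ c₁ ∷ c₂ ∷ o ∷ []) ⟩
    c₁ * (5 + 6 * k) + (c₂ * (8 + 6 * k) + 0) + (3 * c₁ + (8 + 6 * k) * suc o)
      ≡⟨ cong (_+ (3 * c₁ + (8 + 6 * k) * suc o)) eq ⟨
    (4 + 3 * k) * (3 + 2 * k) + (3 * c₁ + (8 + 6 * k) * suc o)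
      ≡⟨ solve (k ∷ c₁ ∷ o ∷ []) ⟩
    (8 + 6 * k) * (2 + k) + suc (3 + 3 * k + 3 * c₁ + (8 + 6 * k) * o) ∎))
  where open ≡-Reasoning
... | tri≈ _ c₁+c₂≡2+k _ = 3∤2 c₂ (+-cancelˡ-≡ ((5 + 6 * k) * (2 + k)) (c₂ * 3) 2 (begin
    (5 + 6 * k) * (2 + k) + c₂ * 3             ≡⟨ cong (λ s → (5 + 6 * k) * s + c₂ * 3) c₁+c₂≡2+k ⟨
    (5 + 6 * k) * (c₁ + c₂) + c₂ * 3           ≡⟨ solve (k ∷ c₁ ∷ c₂ ∷ []) ⟩
    c₁ * (5 + 6 * k) + (c₂ * (8 + 6 * k) + 0)  ≡⟨ eq ⟨
    (4 + 3 * k) * (3 + 2 * k)                  ≡⟨ solve (k ∷ []) ⟩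
    (5 + 6 * k) * (2 + k) + 2                  ∎))
  where
  open ≡-Reasoning
  3∤2 : ∀ c → c * 3 ≢ 2
  3∤2 zero    ()
  3∤2 (suc c) ()
... | tri> _ _ 2+k<c₁+c₂ with o , 3+k+o≡c₁+c₂ ← m≤n⇒∃[o]m+o≡n 2+k<c₁+c₂ =
  m+1+n≢m ((4 + 3 * k) * (3 + 2 * k)) (sym (begin
    (4 + 3 * k) * (3 + 2 * k)                  ≡⟨ eq ⟩
    c₁ * (5 + 6 * k) + (c₂ * (8 + 6 * k) + 0)  ≡⟨ solve (k ∷ c₁ ∷ c₂ ∷ []) ⟩
    (5 + 6 * k) * (c₁ + c₂) + c₂ * 3           ≡⟨ cong (λ s → (5 + 6 * k) * s + c₂ * 3) 3+k+o≡c₁+c₂ ⟨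
    (5 + 6 * k) * (suc (2 + k) + o) + c₂ * 3   ≡⟨ solve (k ∷ o ∷ c₂ ∷ []) ⟩
    (4 + 3 * k) * (3 + 2 * k) + suc (2 + 6 * k + (5 + 6 * k) * o + c₂ * 3) ∎))
  where open ≡-Reasoning

telescopic-6k+1 : ∀ k → Telescopic (THs (1 + k * 6))
telescopic-6k+1 k = subst Telescopic (sym factorisation) (from
  (telescopic-shape⇔ (1 + 2 * k) (1 + 3 * k) (1 + 6 * k) (4 + 6 * k) ((2 + 3 * k) * (5 + 6 * k))
                     ((2 + 3 * k) * (5 + 6 * k) * (2 + 2 * k))
    (Bézout⇒coprime (1 + 6 * k) (4 + 6 * k) (Bézout.+- (1 + 2 * k) (2 * k) (solve (k ∷ []))))
    (coprime-*ʳ (Bézout⇒coprime (1 + 3 * k) (2 + 3 * k) (Bézout.-+ 1 1 (solve (k ∷ []))))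
                (Bézout⇒coprime (1 + 3 * k) (5 + 6 * k) (Bézout.+- (1 + 2 * k) k (solve (k ∷ []))))))
  (coprime-*ʳ (coprime-*ʳ (Bézout⇒coprime (1 + 2 * k) (2 + 3 * k) (Bézout.-+ 3 2 (solve (k ∷ []))))
                          (Bézout⇒coprime (1 + 2 * k) (5 + 6 * k) (Bézout.-+ (4 + 3 * k) (1 + k) (solve (k ∷ [])))))
              (Bézout⇒coprime (1 + 2 * k) (2 + 2 * k) (Bézout.-+ 1 1 (solve (k ∷ [])))) ,
   nnComb₂ (2 + 3 * k) 2 v≡ ,
   nnComb₃ 0 0 (2 + 2 * k) a₃≡))
  where
  factorisation : THs (1 + k * 6) ≡
    (1 + 2 * k) * (1 + 3 * k) * (1 + 6 * k) ∷ (1 + 2 * k) * (1 + 3 * k) * (4 + 6 * k) ∷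
    (1 + 2 * k) * ((2 + 3 * k) * (5 + 6 * k)) ∷ (2 + 3 * k) * (5 + 6 * k) * (2 + 2 * k) ∷ []
  factorisation = THs≡ (1 + k * 6) (solve (k ∷ [])) (solve (k ∷ [])) (solve (k ∷ [])) (solve (k ∷ []))
  v≡ : (2 + 3 * k) * (5 + 6 * k) ≡ (2 + 3 * k) * (1 + 6 * k) + 2 * (4 + 6 * k)
  v≡ = solve (k ∷ [])
  a₃≡ : (2 + 3 * k) * (5 + 6 * k) * (2 + 2 * k) ≡
        0 * ((1 + 3 * k) * (1 + 6 * k)) + (0 * ((1 + 3 * k) * (4 + 6 * k)) +
                                            (2 + 2 * k) * ((2 + 3 * k) * (5 + 6 * k)))
  a₃≡ = solve (k ∷ [])

telescopic-6k+2 : ∀ k → Telescopic (THs (2 + k * 6))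
telescopic-6k+2 k = subst Telescopic (sym factorisation) (from
  (telescopic-shape⇔ (2 + 3 * k) (1 + 2 * k) (2 + 6 * k) (5 + 6 * k) ((5 + 6 * k) * (2 + 2 * k))
                     ((5 + 6 * k) * (1 + k) * (7 + 6 * k))
    (Bézout⇒coprime (2 + 6 * k) (5 + 6 * k) (Bézout.-+ (2 + 2 * k) (1 + 2 * k) (solve (k ∷ []))))
    (coprime-*ʳ (Bézout⇒coprime (1 + 2 * k) (5 + 6 * k) (Bézout.-+ (4 + 3 * k) (1 + k) (solve (k ∷ []))))
                (Bézout⇒coprime (1 + 2 * k) (2 + 2 * k) (Bézout.-+ 1 1 (solve (k ∷ []))))))
  (coprime-*ʳ (coprime-*ʳ (Bézout⇒coprime (2 + 3 * k) (5 + 6 * k) (Bézout.-+ 2 1 (solve (k ∷ []))))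
                          (Bézout⇒coprime (2 + 3 * k) (1 + k) (Bézout.-+ 1 3 (solve (k ∷ [])))))
              (Bézout⇒coprime (2 + 3 * k) (7 + 6 * k) (Bézout.-+ (3 + 2 * k) (1 + k) (solve (k ∷ [])))) ,
   nnComb₂ 0 (2 + 2 * k) v≡ ,
   nnComb₃ 0 (1 + k) (3 + 2 * k) a₃≡))
  where
  factorisation : THs (2 + k * 6) ≡
    (2 + 3 * k) * (1 + 2 * k) * (2 + 6 * k) ∷ (2 + 3 * k) * (1 + 2 * k) * (5 + 6 * k) ∷
    (2 + 3 * k) * ((5 + 6 * k) * (2 + 2 * k)) ∷ (5 + 6 * k) * (1 + k) * (7 + 6 * k) ∷ []
  factorisation = THs≡ (2 + k * 6) (solve (k ∷ [])) (solve (k ∷ [])) (solve (k ∷ [])) (solve (k ∷ []))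
  v≡ : (5 + 6 * k) * (2 + 2 * k) ≡ 0 * (2 + 6 * k) + (2 + 2 * k) * (5 + 6 * k)
  v≡ = solve (k ∷ [])
  a₃≡ : (5 + 6 * k) * (1 + k) * (7 + 6 * k) ≡
        0 * ((1 + 2 * k) * (2 + 6 * k)) + ((1 + k) * ((1 + 2 * k) * (5 + 6 * k)) +
                                            (3 + 2 * k) * ((5 + 6 * k) * (2 + 2 * k)))
  a₃≡ = solve (k ∷ [])

telescopic-6k+3 : ∀ k → Telescopic (THs (3 + k * 6))
telescopic-6k+3 k = subst Telescopic (sym factorisation) (from
  (telescopic-shape⇔ (5 + 6 * k) (2 + 3 * k) (1 + 2 * k) (2 + 2 * k) ((1 + k) * (7 + 6 * k))
                     ((1 + k) * (7 + 6 * k) * (8 + 6 * k))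
    (Bézout⇒coprime (1 + 2 * k) (2 + 2 * k) (Bézout.-+ 1 1 (solve (k ∷ []))))
    (coprime-*ʳ (Bézout⇒coprime (2 + 3 * k) (1 + k) (Bézout.-+ 1 3 (solve (k ∷ []))))
                (Bézout⇒coprime (2 + 3 * k) (7 + 6 * k) (Bézout.-+ (3 + 2 * k) (1 + k) (solve (k ∷ []))))))
  (coprime-*ʳ (coprime-*ʳ (Bézout⇒coprime (5 + 6 * k) (1 + k) (Bézout.-+ 1 6 (solve (k ∷ []))))
                          (Bézout⇒coprime (5 + 6 * k) (7 + 6 * k) (Bézout.-+ (4 + 3 * k) (3 + 3 * k) (solve (k ∷ [])))))
              (Bézout⇒coprime (5 + 6 * k) (8 + 6 * k) (Bézout.-+ (3 + 2 * k) (2 + 2 * k) (solve (k ∷ [])))) ,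
   nnComb₂ (1 + k) (3 + 2 * k) v≡ ,
   nnComb₃ 0 0 (8 + 6 * k) a₃≡))
  where
  factorisation : THs (3 + k * 6) ≡
    (5 + 6 * k) * (2 + 3 * k) * (1 + 2 * k) ∷ (5 + 6 * k) * (2 + 3 * k) * (2 + 2 * k) ∷
    (5 + 6 * k) * ((1 + k) * (7 + 6 * k)) ∷ (1 + k) * (7 + 6 * k) * (8 + 6 * k) ∷ []
  factorisation = THs≡ (3 + k * 6) (solve (k ∷ [])) (solve (k ∷ [])) (solve (k ∷ [])) (solve (k ∷ []))
  v≡ : (1 + k) * (7 + 6 * k) ≡ (1 + k) * (1 + 2 * k) + (3 + 2 * k) * (2 + 2 * k)
  v≡ = solve (k ∷ [])
  a₃≡ : (1 + k) * (7 + 6 * k) * (8 + 6 * k) ≡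
        0 * ((2 + 3 * k) * (1 + 2 * k)) + (0 * ((2 + 3 * k) * (2 + 2 * k)) +
                                            (8 + 6 * k) * ((1 + k) * (7 + 6 * k)))
  a₃≡ = solve (k ∷ [])

telescopic-6k+6 : ∀ k → Telescopic (THs (6 + k * 6))
telescopic-6k+6 k = subst Telescopic (sym factorisation) (from
  (telescopic-shape⇔ (4 + 3 * k) (7 + 6 * k) (2 + 2 * k) (3 + 2 * k) ((3 + 2 * k) * (10 + 6 * k))
                     ((3 + 2 * k) * (5 + 3 * k) * (11 + 6 * k))
    (Bézout⇒coprime (2 + 2 * k) (3 + 2 * k) (Bézout.-+ 1 1 (solve (k ∷ []))))
    (coprime-*ʳ (Bézout⇒coprime (7 + 6 * k) (3 + 2 * k) (Bézout.-+ (2 + k) (5 + 3 * k) (solve (k ∷ []))))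
                (Bézout⇒coprime (7 + 6 * k) (10 + 6 * k) (Bézout.+- (3 + 2 * k) (2 + 2 * k) (solve (k ∷ []))))))
  (coprime-*ʳ (coprime-*ʳ (Bézout⇒coprime (4 + 3 * k) (3 + 2 * k) (Bézout.-+ 2 3 (solve (k ∷ []))))
                          (Bézout⇒coprime (4 + 3 * k) (5 + 3 * k) (Bézout.-+ 1 1 (solve (k ∷ [])))))
              (Bézout⇒coprime (4 + 3 * k) (11 + 6 * k) (Bézout.+- (3 + 2 * k) (1 + k) (solve (k ∷ [])))) ,
   nnComb₂ 0 (10 + 6 * k) v≡ ,
   nnComb₃ 0 (5 + 3 * k) 2 a₃≡))
  where
  factorisation : THs (6 + k * 6) ≡
    (4 + 3 * k) * (7 + 6 * k) * (2 + 2 * k) ∷ (4 + 3 * k) * (7 + 6 * k) * (3 + 2 * k) ∷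
    (4 + 3 * k) * ((3 + 2 * k) * (10 + 6 * k)) ∷ (3 + 2 * k) * (5 + 3 * k) * (11 + 6 * k) ∷ []
  factorisation = THs≡ (6 + k * 6) (solve (k ∷ [])) (solve (k ∷ [])) (solve (k ∷ [])) (solve (k ∷ []))
  v≡ : (3 + 2 * k) * (10 + 6 * k) ≡ 0 * (2 + 2 * k) + (10 + 6 * k) * (3 + 2 * k)
  v≡ = solve (k ∷ [])
  a₃≡ : (3 + 2 * k) * (5 + 3 * k) * (11 + 6 * k) ≡
        0 * ((7 + 6 * k) * (2 + 2 * k)) + ((5 + 3 * k) * ((7 + 6 * k) * (3 + 2 * k)) +
                                            2 * ((3 + 2 * k) * (10 + 6 * k)))
  a₃≡ = solve (k ∷ [])

¬telescopic-6k+5 : ∀ k → ¬ Telescopic (THs (5 + k * 6))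
¬telescopic-6k+5 k tel = [4+3k][3+2k]∉⟨5+6k,8+6k⟩ k (proj₁ (proj₂ (to
  (telescopic-shape⇔ (7 + 6 * k) (1 + k) (5 + 6 * k) (8 + 6 * k) ((4 + 3 * k) * (3 + 2 * k))
                     ((4 + 3 * k) * (3 + 2 * k) * (10 + 6 * k))
    (Bézout⇒coprime (5 + 6 * k) (8 + 6 * k) (Bézout.-+ (3 + 2 * k) (2 + 2 * k) (solve (k ∷ []))))
    (coprime-*ʳ (Bézout⇒coprime (1 + k) (4 + 3 * k) (Bézout.-+ 3 1 (solve (k ∷ []))))
                (Bézout⇒coprime (1 + k) (3 + 2 * k) (Bézout.-+ 2 1 (solve (k ∷ []))))))
  (subst Telescopic factorisation tel))))
  where
  factorisation : THs (5 + k * 6) ≡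
    (7 + 6 * k) * (1 + k) * (5 + 6 * k) ∷ (7 + 6 * k) * (1 + k) * (8 + 6 * k) ∷
    (7 + 6 * k) * ((4 + 3 * k) * (3 + 2 * k)) ∷ (4 + 3 * k) * (3 + 2 * k) * (10 + 6 * k) ∷ []
  factorisation = THs≡ (5 + k * 6) (solve (k ∷ [])) (solve (k ∷ [])) (solve (k ∷ [])) (solve (k ∷ []))

-- The factor 7 + 6k of a₃ also divides the last two generators and is coprime to the first,
-- so it cancels, leaving the combination already excluded in the case 6k + 5.
¬telescopic-6k+4 : ∀ k → ¬ Telescopic (THs (4 + k * 6))
¬telescopic-6k+4 k tel =
  [4+3k][3+2k]∉⟨5+6k,8+6k⟩ k (IsNNComb-cancel {h₁ = 5 + 6 * k} {h₂ = 8 + 6 * k} p⊥g t<g a₃∈)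
  where
  factorisation : THs (4 + k * 6) ≡
    (1 + k) * (5 + 6 * k) * (4 + 6 * k) ∷ (1 + k) * (5 + 6 * k) * (7 + 6 * k) ∷
    (1 + k) * ((8 + 6 * k) * (7 + 6 * k)) ∷ (4 + 3 * k) * (3 + 2 * k) * (7 + 6 * k) ∷ []
  factorisation = THs≡ (4 + k * 6) (solve (k ∷ [])) (solve (k ∷ [])) (solve (k ∷ [])) (solve (k ∷ []))
  a₃∈ : IsNNComb ((4 + 3 * k) * (3 + 2 * k) * (7 + 6 * k))
                 ((5 + 6 * k) * (4 + 6 * k) ∷ (5 + 6 * k) * (7 + 6 * k) ∷ (8 + 6 * k) * (7 + 6 * k) ∷ [])
  a₃∈ = proj₂ (proj₂ (to
    (telescopic-shape⇔ (1 + k) (5 + 6 * k) (4 + 6 * k) (7 + 6 * k) ((8 + 6 * k) * (7 + 6 * k))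
                       ((4 + 3 * k) * (3 + 2 * k) * (7 + 6 * k))
      (Bézout⇒coprime (4 + 6 * k) (7 + 6 * k) (Bézout.+- (2 + 2 * k) (1 + 2 * k) (solve (k ∷ []))))
      (coprime-*ʳ (Bézout⇒coprime (5 + 6 * k) (8 + 6 * k) (Bézout.-+ (3 + 2 * k) (2 + 2 * k) (solve (k ∷ []))))
                  (Bézout⇒coprime (5 + 6 * k) (7 + 6 * k) (Bézout.-+ (4 + 3 * k) (3 + 3 * k) (solve (k ∷ []))))))
    (subst Telescopic factorisation tel)))
  p⊥g : Coprime (7 + 6 * k) ((5 + 6 * k) * (4 + 6 * k))
  p⊥g = coprime-*ʳ (Bézout⇒coprime (7 + 6 * k) (5 + 6 * k) (Bézout.-+ (2 + 3 * k) (3 + 3 * k) (solve (k ∷ []))))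
                   (Bézout⇒coprime (7 + 6 * k) (4 + 6 * k) (Bézout.-+ (1 + 2 * k) (2 + 2 * k) (solve (k ∷ []))))
  t<g : (4 + 3 * k) * (3 + 2 * k) < (5 + 6 * k) * (4 + 6 * k)
  t<g = subst ((4 + 3 * k) * (3 + 2 * k) <_) gap (m<m+n _ (s≤s z≤n))
    where
    gap : (4 + 3 * k) * (3 + 2 * k) + suc (7 + 37 * k + 30 * (k * k)) ≡ (5 + 6 * k) * (4 + 6 * k)
    gap = solve (k ∷ [])

telescopic⇔residue : ∀ q r → r < 6 → 1 ≤ r + q * 6 →
  Telescopic (THs (r + q * 6)) ⇔ (r ≡ 0 ⊎ r ≡ 1 ⊎ r ≡ 2 ⊎ r ≡ 3)
telescopic⇔residue zero    0 _ ()
telescopic⇔residue (suc k) 0 _ _ = mk⇔ (const (inj₁ refl)) (const (telescopic-6k+6 k))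
telescopic⇔residue k 1 _ _ = mk⇔ (const (inj₂ (inj₁ refl))) (const (telescopic-6k+1 k))
telescopic⇔residue k 2 _ _ = mk⇔ (const (inj₂ (inj₂ (inj₁ refl)))) (const (telescopic-6k+2 k))
telescopic⇔residue k 3 _ _ = mk⇔ (const (inj₂ (inj₂ (inj₂ refl)))) (const (telescopic-6k+3 k))
telescopic⇔residue k 4 _ _ = mk⇔ (⊥-elim ∘ ¬telescopic-6k+4 k) λ where
  (inj₁ ()) ; (inj₂ (inj₁ ())) ; (inj₂ (inj₂ (inj₁ ()))) ; (inj₂ (inj₂ (inj₂ ())))
telescopic⇔residue k 5 _ _ = mk⇔ (⊥-elim ∘ ¬telescopic-6k+5 k) λ where
  (inj₁ ()) ; (inj₂ (inj₁ ())) ; (inj₂ (inj₂ (inj₁ ()))) ; (inj₂ (inj₂ (inj₂ ())))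
telescopic⇔residue k (suc (suc (suc (suc (suc (suc _)))))) (s≤s (s≤s (s≤s (s≤s (s≤s (s≤s ())))))) _

proposition10 : (n : ℕ) → 1 ≤ n →
    Telescopic (TH n ∷ TH (n + 1) ∷ TH (n + 2) ∷ TH (n + 3) ∷ [])
      ⇔ ((n % 6 ≡ 0) ⊎ (n % 6 ≡ 1) ⊎ (n % 6 ≡ 2) ⊎ (n % 6 ≡ 3))
proposition10 n 1≤n =
  subst (λ m → Telescopic (THs m) ⇔ (n % 6 ≡ 0 ⊎ n % 6 ≡ 1 ⊎ n % 6 ≡ 2 ⊎ n % 6 ≡ 3)) (sym n≡r+q*6)
    (telescopic⇔residue (n / 6) (n % 6) (m%n<n n 6) (subst (1 ≤_) n≡r+q*6 1≤n))
  where
  n≡r+q*6 : n ≡ n % 6 + n / 6 * 6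
  n≡r+q*6 = m≡m%n+[m/n]*n n 6
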